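{- Let $l,t,s,n$ be integers with $2\le l\le t$, $s\ge l+1\ge 3$ and $n\ge 2\binom{3s}{2}$. Then for every integer $1\le x\le l-1$, $$ex(n,\{K_{l,t},M_{s+1}\},l-1)\ge ex(n,\{K_{l,t},M_{s+1}\},x).$$
   Context: All graphs are finite, simple and undirected. $K_{l,t}$ is the complete bipartite graph with parts of sizes $l,t$ and $M_{s+1}$ is a matching of $s+1$ pairwise disjoint edges; $\{K_{l,t},M_{s+1}\}$-free means containing neither as a subgraph. For a graph $G$ with matching number at most $s$, let $\mathscr{X}(G)$ be the set of subsets $X\subseteq V(G)$ such that $|X|+\sum_{i=1}^m\lfloor |V(C_i)|/2\rfloor\le s$, where $C_1,\dots,C_m$ are the connected components of $G-X$, and let $x(G)=\max\{|X|: X\in\mathscr{X}(G)\}$. Let $\mathscr{G}_x$ be the set of $\{K_{l,t},M_{s+1}\}$-free graphs $G$ on $n$ vertices with $x(G)=x$, and $ex(n,\{K_{l,t},M_{s+1}\},x)=\max_{G\in\mathscr{G}_x}e(G)$, where $e(G)$ is the number of edges. -}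

module Defs where

open import Data.Nat using (ℕ; zero; suc; _+_; _*_; _≤_; _<_; _<ᵇ_; ⌊_/2⌋)
open import Data.Bool using (Bool; true; false; if_then_else_; _∧_; not)
open import Data.Fin using (Fin; toℕ; _↑ˡ_; _↑ʳ_)
open import Data.Fin.Subset using (Subset; _∉_; ∣_∣)
open import Data.Vec using (lookup)
open import Data.List using (List; map; allFin)
open import Data.Nat.ListAction using (sum)
open import Data.Product using (Σ; _×_; ∃)
open import Data.Sum using (_⊎_)
open import Relation.Nullary.Decidable using (⌊_⌋)
open import Relation.Binary.PropositionalEquality using (_≡_)
open import Function using (Injective; _⇔_)
import Data.Fin as F

record Graph (n : ℕ) : Set where
  field
    adj    : Fin n → Fin n → Bool
    sym    : ∀ i j → adj i j ≡ adj j i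
    irrefl : ∀ i → adj i i ≡ false
open Graph public

Adj : ∀ {n} → Graph n → Fin n → Fin n → Set
Adj G i j = adj G i j ≡ true

e : ∀ {n} → Graph n → ℕ
e {n} G = sum (map (λ i → sum (map (λ j →
            if (toℕ i <ᵇ toℕ j) ∧ adj G i j then 1 else 0) (allFin n))) (allFin n))

-- G contains K_{l,t} as a subgraph: an injective placement of the
-- l + t vertices (first l form one part, last t the other) such that
-- every vertex of the first part is adjacent to every vertex of the second.
ContainsK : ∀ {n} → ℕ → ℕ → Graph n → Set
ContainsK {n} l t G =
  Σ (Fin (l + t) → Fin n) λ f → Injective _≡_ _≡_ f ×
    (∀ (i : Fin l) (j : Fin t) → Adj G (f (i ↑ˡ t)) (f (l ↑ʳ j)))

-- G contains a matching M_k of k pairwise disjoint edges: an injective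
-- placement of 2k vertices such that vertex i is adjacent to vertex k+i.
ContainsM : ∀ {n} → ℕ → Graph n → Set
ContainsM {n} k G =
  Σ (Fin (k + k) → Fin n) λ f → Injective _≡_ _≡_ f ×
    (∀ (i : Fin k) → Adj G (f (i ↑ˡ k)) (f (k ↑ʳ i)))

Free : ∀ {n} → ℕ → ℕ → ℕ → Graph n → Set
Free l t s G = (ContainsK l t G → Data.Empty.⊥) × (ContainsM (suc s) G → Data.Empty.⊥)
  where import Data.Empty

data Reach {n} (G : Graph n) (X : Subset n) : Fin n → Fin n → Set where
  here : ∀ {v} → v ∉ X → Reach G X v v
  step : ∀ {u v w} → u ∉ X → Adj G u v → Reach G X v w → Reach G X u w

-- a labelling of the vertices of G - X whose classes are exactly the
-- connected components of G - X
IsComponentLabelling : ∀ {n} → Graph n → Subset n → (Fin n → Fin n) → Set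
IsComponentLabelling G X c =
  ∀ u v → u ∉ X → v ∉ X → (c u ≡ c v ⇔ Reach G X u v)

classSize : ∀ {n} → Subset n → (Fin n → Fin n) → Fin n → ℕ
classSize {n} X c k =
  sum (map (λ v → if not (lookup X v) ∧ ⌊ c v F.≟ k ⌋ then 1 else 0) (allFin n))

-- |X| + Σ_components ⌊|C_i|/2⌋, computed via a component labelling
cost : ∀ {n} → Subset n → (Fin n → Fin n) → ℕ
cost {n} X c = ∣ X ∣ + sum (map (λ k → ⌊ classSize X c k /2⌋) (allFin n))

InXset : ∀ {n} → ℕ → Graph n → Subset n → Set
InXset s G X = Σ _ λ c → IsComponentLabelling G X c × cost X c ≤ s

HasX : ∀ {n} → ℕ → Graph n → ℕ → Set
HasX s G x = (Σ _ λ X → InXset s G X × ∣ X ∣ ≡ x) ×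
             (∀ X → InXset s G X → ∣ X ∣ ≤ x)

InGx : ∀ {n} → ℕ → ℕ → ℕ → ℕ → Graph n → Set
InGx l t s x G = Free l t s G × HasX s G x

{-# OPTIONS --safe #-}
-- Let a = l - 1 and s = a + m. If x = a take H = G. Otherwise compare G with
-- H = K_a + (m K₃ ∪ (n - a - 3m) K₁), whose a apexes are joined to every vertex.
-- H has no K_{a+1,t} (t ≥ 3), since two adjacent non-apex vertices pin down one triangle,
-- and no M_{s+1}, since every edge uses an apex or lies in a triangle.  The apex set lies in
-- 𝒳(H), and any larger member of 𝒳(H) either misses an apex, leaving one component of size
-- at least n - s, or contains every apex and some further vertex, after which each triangle
-- still costs at least one; so x(H) = a, while e(H) ≥ a(n - a).
-- On the other side, for X ∈ 𝒳(G) with |X| = x every edge of G meets X or lies in a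
-- component of G - X with at least two vertices, and these components have at most 3s
-- vertices in total; so 2e(G) ≤ 2nx + 9s², which is at most 2a(n - a) as n ≥ 9s² - 3s.
module Submission where

open import Defs hiding (sym)
open import Data.Nat using (ℕ; _+_; _*_; _∸_; _≤_; suc; zero; _<_; _<ᵇ_; _⊓_; z≤n; s≤s; ⌊_/2⌋; _/_; _%_; NonZero; >-nonZero)
open import Data.Nat.Combinatorics using (_C_; nCk+nC[k+1]≡[n+1]C[k+1]; nC1≡n)
open import Data.Product using (Σ; _×_; _,_; proj₁; proj₂; ∃)

open import Data.Bool using (Bool; true; false; if_then_else_; _∧_; _∨_; not)
open import Data.Bool.Properties using (∧-zeroʳ; ∧-identityʳ; ∨-zeroʳ; ¬-not; not-injective) renaming (_≟_ to _≟ᵇ_)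
open import Data.Empty using (⊥; ⊥-elim)
open import Data.Fin as Fin using (Fin; toℕ; fromℕ; fromℕ<; _↑ˡ_; _↑ʳ_; splitAt)
open import Data.Fin.Patterns using (0F; 1F; 2F)
import Data.Fin.Properties as Finₚ
open import Data.Fin.Subset using (Subset; ∣_∣; _∉_)
open import Data.List using (map; allFin; tabulate)
import Data.List.Properties as Listₚ
import Data.Nat.ListAction as List
open import Data.Nat.DivMod
  using (m≡m%n+[m/n]*n; m%n<n; [m+kn]%n≡m%n; m<n⇒m%n≡m; +-distrib-/-∣ʳ; m<n⇒m/n≡0; m*n/n≡m)
open import Data.Nat.Divisibility using (divides)
open import Data.Nat.Properties
open import Algebra.Properties.Semiring.Sum +-*-semiring
  using (sum-syntax; ∑-distrib-+; ∑-comm; sum-cong-≗; *-distribˡ-sum; *-distribʳ-sum)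
  renaming (sum to ∑)
open import Data.Nat.Solver using (module +-*-Solver)
open +-*-Solver using (solve; _:+_; _:*_; _:=_; con)
open import Data.Sum using (_⊎_; inj₁; inj₂)
open import Data.Vec using (Vec; _∷_; []; lookup)
import Data.Vec as Vec
open import Data.Vec.Properties using ([]=⇒lookup; lookup⇒[]=; lookup∘tabulate)
open import Data.Vec.Relation.Unary.All as All using (All; _∷_; [])
open import Data.Vec.Relation.Unary.All.Properties using (lookup⁺)
open import Data.Vec.Relation.Unary.AllPairs using (_∷_; [])
open import Data.Vec.Relation.Unary.Unique.Propositional using (Unique)
open import Data.Vec.Relation.Unary.Unique.Propositional.Properties using (lookup-injective)
open import Function using (_∘_; module Equivalence; mk⇔)
open import Relation.Binary using (tri<; tri≈; tri>)
open import Relation.Binary.PropositionalEquality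
open import Relation.Nullary using (¬_; Dec; yes; no; does; contradiction)
open import Relation.Nullary.Decidable
  using (⌊_⌋; dec-true; dec-false; isYes≗does; does-⇔; _×-dec_; _⊎-dec_; ¬?; decidable-stable)

-- Finite sums and counting

∑-mono-≤ : ∀ {n} {f g : Fin n → ℕ} → (∀ i → f i ≤ g i) → ∑ f ≤ ∑ g
∑-mono-≤ {zero}  f≤g = z≤n
∑-mono-≤ {suc n} f≤g = +-mono-≤ (f≤g Fin.zero) (∑-mono-≤ (f≤g ∘ Fin.suc))

∑-const : ∀ n c → ∑[ i < n ] c ≡ n * c
∑-const zero    c = refl
∑-const (suc n) c = cong (c +_) (∑-const n c)

term≤∑ : ∀ {n} (f : Fin n → ℕ) i → f i ≤ ∑ f
term≤∑ f Fin.zero    = m≤m+n _ _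
term≤∑ f (Fin.suc i) = ≤-trans (term≤∑ (f ∘ Fin.suc) i) (m≤n+m _ _)

∑-delta : ∀ {n} (a : Fin n) (f : Fin n → ℕ) →
          ∑[ k < n ] (if ⌊ a Fin.≟ k ⌋ then f k else 0) ≡ f a
∑-delta {suc n} Fin.zero f = begin
  f Fin.zero + ∑[ k < n ] 0 ≡⟨ cong (f Fin.zero +_) (trans (∑-const n 0) (*-zeroʳ n)) ⟩
  f Fin.zero + 0            ≡⟨ +-identityʳ _ ⟩
  f Fin.zero                ∎
  where open ≡-Reasoning
∑-delta {suc n} (Fin.suc a) f = trans (sum-cong-≗ shift) (∑-delta a (f ∘ Fin.suc))
  where
  shift : ∀ k → (if ⌊ Fin.suc a Fin.≟ Fin.suc k ⌋ then f (Fin.suc k) else 0)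
              ≡ (if ⌊ a Fin.≟ k ⌋ then f (Fin.suc k) else 0)
  shift k with a Fin.≟ k
  ... | yes _ = refl
  ... | no  _ = refl

sum-map-allFin : ∀ {n} (f : Fin n → ℕ) → List.sum (map f (allFin n)) ≡ ∑ f
sum-map-allFin {n} f = trans (cong List.sum (Listₚ.map-tabulate (λ i → i) f)) (go f)
  where
  go : ∀ {n} (f : Fin n → ℕ) → List.sum (tabulate f) ≡ ∑ f
  go {zero}  f = refl
  go {suc n} f = cong (f Fin.zero +_) (go (f ∘ Fin.suc))

↑ˡ≢↑ʳ : ∀ {m n} (i : Fin m) (j : Fin n) → i ↑ˡ n ≢ m ↑ʳ j
↑ˡ≢↑ʳ {m} {n} i j eq
  with () ← trans (sym (Finₚ.splitAt-↑ˡ m i n)) (trans (cong (splitAt m) eq) (Finₚ.splitAt-↑ʳ m n j))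

↑-view : ∀ m {n} (p : Fin (m + n)) → (∃ λ i → i ↑ˡ n ≡ p) ⊎ (∃ λ j → m ↑ʳ j ≡ p)
↑-view m p with splitAt m p in eq
... | inj₁ i = inj₁ (i , Finₚ.splitAt⁻¹-↑ˡ eq)
... | inj₂ j = inj₂ (j , Finₚ.splitAt⁻¹-↑ʳ eq)

two-of-three-agree : (b : Fin 3 → Bool) → ∃ λ r → ∃ λ r′ → r ≢ r′ × b r ≡ b r′
two-of-three-agree b with b 0F ≟ᵇ b 1F | b 0F ≟ᵇ b 2F
... | yes b₀≡b₁ | _         = 0F , 1F , (λ ()) , b₀≡b₁
... | no _      | yes b₀≡b₂ = 0F , 2F , (λ ()) , b₀≡b₂
... | no b₀≢b₁  | no b₀≢b₂  = 1F , 2F , (λ ()) , trans (¬-not (b₀≢b₁ ∘ sym)) (sym (¬-not (b₀≢b₂ ∘ sym)))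

𝟙 : Bool → ℕ
𝟙 b = if b then 1 else 0

count : ∀ {n} → (Fin n → Bool) → ℕ
count {n} p = ∑[ i < n ] 𝟙 (p i)

count-mono : ∀ {n} {p q : Fin n → Bool} → (∀ i → p i ≡ true → q i ≡ true) → count p ≤ count q
count-mono {p = p} {q} p⊆q = ∑-mono-≤ pointwise
  where
  pointwise : ∀ i → 𝟙 (p i) ≤ 𝟙 (q i)
  pointwise i with p i in pᵢ
  ... | false = z≤n
  ... | true  rewrite p⊆q i pᵢ = ≤-refl

count-true : ∀ n → count {n} (λ _ → true) ≡ n
count-true n = trans (∑-const n 1) (*-identityʳ n)

count-∨ : ∀ {n} (p q : Fin n → Bool) → count (λ i → p i ∨ q i) ≤ count p + count q
count-∨ p q = ≤-trans (∑-mono-≤ (λ i → 𝟙-∨ (p i) (q i))) (≤-reflexive (∑-distrib-+ (𝟙 ∘ p) (𝟙 ∘ q)))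
  where
  𝟙-∨ : ∀ x y → 𝟙 (x ∨ y) ≤ 𝟙 x + 𝟙 y
  𝟙-∨ true  y = s≤s z≤n
  𝟙-∨ false y = ≤-refl

count-complement : ∀ {n} (p : Fin n → Bool) → count p + count (not ∘ p) ≡ n
count-complement {n} p = begin
  count p + count (not ∘ p)         ≡⟨ ∑-distrib-+ (𝟙 ∘ p) (𝟙 ∘ not ∘ p) ⟨
  ∑[ i < n ] (𝟙 (p i) + 𝟙 (not (p i))) ≡⟨ sum-cong-≗ (λ i → 𝟙-not (p i)) ⟩
  ∑[ i < n ] 1                      ≡⟨ count-true n ⟩
  n                                 ∎
  where
  open ≡-Reasoning
  𝟙-not : ∀ b → 𝟙 b + 𝟙 (not b) ≡ 1
  𝟙-not true  = refl
  𝟙-not false = refl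

count-split : ∀ {n} (p q : Fin n → Bool) → count p ≡ count (λ v → p v ∧ q v) + count (λ v → p v ∧ not (q v))
count-split p q = trans (sum-cong-≗ (λ v → 𝟙-split (p v) (q v)))
                        (∑-distrib-+ (λ v → 𝟙 (p v ∧ q v)) (λ v → 𝟙 (p v ∧ not (q v))))
  where
  𝟙-split : ∀ x y → 𝟙 x ≡ 𝟙 (x ∧ y) + 𝟙 (x ∧ not y)
  𝟙-split true  true  = refl
  𝟙-split true  false = refl
  𝟙-split false y     = refl

remove : ∀ {n} → (Fin n → Bool) → Fin n → Fin n → Bool
remove p v w = p w ∧ not ⌊ v Fin.≟ w ⌋

count-remove : ∀ {n} (p : Fin n → Bool) v → p v ≡ true → count p ≡ suc (count (remove p v))
count-remove {n} p v pᵥ = begin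
  count p                                                      ≡⟨ sum-cong-≗ split ⟩
  ∑[ w < n ] (𝟙 (remove p v w) + δ w)                          ≡⟨ ∑-distrib-+ (𝟙 ∘ remove p v) δ ⟩
  count (remove p v) + ∑[ w < n ] δ w                          ≡⟨ cong (count (remove p v) +_) (∑-delta v (λ _ → 1)) ⟩
  count (remove p v) + 1                                       ≡⟨ +-comm _ 1 ⟩
  suc (count (remove p v))                                     ∎
  where
  open ≡-Reasoning
  δ : Fin n → ℕ
  δ w = if ⌊ v Fin.≟ w ⌋ then 1 else 0
  split : ∀ w → 𝟙 (p w) ≡ 𝟙 (remove p v w) + δ w
  split w with v Fin.≟ w
  ... | yes refl rewrite pᵥ = refl
  ... | no _ with p w
  ...   | true  = refl
  ...   | false = refl

count-injection : ∀ {m n} (q : Fin m → Bool) (p : Fin n → Bool) (f : Fin m → Fin n) →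
                  (∀ i → q i ≡ true → p (f i) ≡ true) →
                  (∀ i j → q i ≡ true → q j ≡ true → f i ≡ f j → i ≡ j) →
                  count q ≤ count p
count-injection {zero}  q p f q⇒p inj = z≤n
count-injection {suc m} q p f q⇒p inj = by-head
  where
  tail≤ : ∀ {p′} → (∀ i → q (Fin.suc i) ≡ true → p′ (f (Fin.suc i)) ≡ true) → count (q ∘ Fin.suc) ≤ count p′
  tail≤ q⇒p′ = count-injection (q ∘ Fin.suc) _ (f ∘ Fin.suc) q⇒p′ λ i j qᵢ qⱼ e → Finₚ.suc-injective (inj _ _ qᵢ qⱼ e)
  by-head : count q ≤ count p
  by-head with q Fin.zero in q₀
  ... | false = tail≤ (q⇒p ∘ Fin.suc)
  ... | true  = begin
    suc (count (q ∘ Fin.suc))           ≤⟨ s≤s (tail≤ q⇒p∖f₀) ⟩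
    suc (count (remove p (f Fin.zero))) ≡⟨ count-remove p (f Fin.zero) (q⇒p Fin.zero q₀) ⟨
    count p                             ∎
    where
    open ≤-Reasoning
    q⇒p∖f₀ : ∀ i → q (Fin.suc i) ≡ true → remove p (f Fin.zero) (f (Fin.suc i)) ≡ true
    q⇒p∖f₀ i qᵢ with f Fin.zero Fin.≟ f (Fin.suc i)
    ... | yes e with () ← inj _ _ q₀ qᵢ e
    ... | no _ rewrite q⇒p (Fin.suc i) qᵢ = refl

injection≤count : ∀ {m n} (p : Fin n → Bool) (f : Fin m → Fin n) →
                  (∀ i → p (f i) ≡ true) → (∀ i j → f i ≡ f j → i ≡ j) → m ≤ count p
injection≤count {m} p f p∘f inj = begin
  m                       ≡⟨ count-true m ⟨
  count {m} (λ _ → true)  ≤⟨ count-injection _ p f (λ i _ → p∘f i) (λ i j _ _ → inj i j) ⟩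
  count p                 ∎
  where open ≤-Reasoning

distinct≤count : ∀ {m n} (p : Fin n → Bool) (vs : Vec (Fin n) m) →
                 Unique vs → All (λ v → p v ≡ true) vs → m ≤ count p
distinct≤count p vs unique all-p = injection≤count p (lookup vs) (lookup⁺ all-p) (lookup-injective unique)

count≤code-bound : ∀ {n} M (p : Fin n → Bool) (code : Fin n → ℕ) →
                   (∀ i → p i ≡ true → code i < M) →
                   (∀ i j → p i ≡ true → p j ≡ true → code i ≡ code j → i ≡ j) →
                   count p ≤ M
count≤code-bound {n} M p code bound inj = begin
  count p                                 ≤⟨ count-injection p (remove (λ _ → true) (fromℕ M)) clamp clamp-below clamp-inj ⟩
  count (remove (λ _ → true) (fromℕ M))   ≡⟨ suc-injective (trans (sym (count-true (suc M)))
                                               (count-remove (λ _ → true) (fromℕ M) refl)) ⟨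
  M                                       ∎
  where
  open ≤-Reasoning
  clamp : Fin n → Fin (suc M)
  clamp i = fromℕ< (s≤s (m⊓n≤n (code i) M))
  toℕ-clamp : ∀ i → p i ≡ true → toℕ (clamp i) ≡ code i
  toℕ-clamp i pᵢ = trans (Finₚ.toℕ-fromℕ< _) (m≤n⇒m⊓n≡m (<⇒≤ (bound i pᵢ)))
  clamp-below : ∀ i → p i ≡ true → remove (λ _ → true) (fromℕ M) (clamp i) ≡ true
  clamp-below i pᵢ with fromℕ M Fin.≟ clamp i
  ... | no _  = refl
  ... | yes e = ⊥-elim (<-irrefl (trans (sym (toℕ-clamp i pᵢ)) (trans (cong toℕ (sym e)) (Finₚ.toℕ-fromℕ M)))
                                  (bound i pᵢ))
  clamp-inj : ∀ i j → p i ≡ true → p j ≡ true → clamp i ≡ clamp j → i ≡ j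
  clamp-inj i j pᵢ pⱼ e =
    inj i j pᵢ pⱼ (trans (sym (toℕ-clamp i pᵢ)) (trans (cong toℕ e) (toℕ-clamp j pⱼ)))

∣∣≡count : ∀ {n} (X : Subset n) → ∣ X ∣ ≡ count (lookup X)
∣∣≡count []          = refl
∣∣≡count (true ∷ X)  = cong suc (∣∣≡count X)
∣∣≡count (false ∷ X) = ∣∣≡count X

witness : ∀ {A : Set} (d : Dec A) → does d ≡ true → A
witness (yes a) _ = a

⌊⌋-true : ∀ {A : Set} (d : Dec A) → A → ⌊ d ⌋ ≡ true
⌊⌋-true d a = trans (isYes≗does d) (dec-true d a)

lookup≡false⇒∉ : ∀ {n} {X : Subset n} {v} → lookup X v ≡ false → v ∉ X
lookup≡false⇒∉ Xᵥ v∈X with () ← trans (sym ([]=⇒lookup v∈X)) Xᵥ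

∉⇒lookup≡false : ∀ {n} {X : Subset n} {v} → v ∉ X → lookup X v ≡ false
∉⇒lookup≡false {X = X} {v} v∉X with lookup X v in Xᵥ
... | false = refl
... | true  = ⊥-elim (v∉X (lookup⇒[]= v X Xᵥ))

∑-by-label : ∀ {n m} (c : Fin n → Fin m) (p : Fin n → Bool) (g : Fin m → ℕ) →
             ∑[ v < n ] (𝟙 (p v) * g (c v)) ≡ ∑[ k < m ] (g k * count (λ v → p v ∧ ⌊ c v Fin.≟ k ⌋))
∑-by-label {n} {m} c p g = begin
  ∑[ v < n ] (𝟙 (p v) * g (c v))                            ≡⟨ sum-cong-≗ (λ v → ∑-delta (c v) (λ k → 𝟙 (p v) * g k)) ⟨
  ∑[ v < n ] ∑[ k < m ] (if ⌊ c v Fin.≟ k ⌋ then 𝟙 (p v) * g k else 0) ≡⟨ sum-cong-≗ (λ v → sum-cong-≗ (term v)) ⟩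
  ∑[ v < n ] ∑[ k < m ] (g k * 𝟙 (p v ∧ ⌊ c v Fin.≟ k ⌋))   ≡⟨ ∑-comm (λ v k → g k * 𝟙 (p v ∧ ⌊ c v Fin.≟ k ⌋)) ⟩
  ∑[ k < m ] ∑[ v < n ] (g k * 𝟙 (p v ∧ ⌊ c v Fin.≟ k ⌋))   ≡⟨ sum-cong-≗ (λ k → *-distribˡ-sum (g k) (λ v → 𝟙 (p v ∧ ⌊ c v Fin.≟ k ⌋))) ⟨
  ∑[ k < m ] (g k * count (λ v → p v ∧ ⌊ c v Fin.≟ k ⌋))    ∎
  where
  open ≡-Reasoning
  term : ∀ v k → (if ⌊ c v Fin.≟ k ⌋ then 𝟙 (p v) * g k else 0) ≡ g k * 𝟙 (p v ∧ ⌊ c v Fin.≟ k ⌋)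
  term v k with c v Fin.≟ k
  ... | yes _ rewrite ∧-identityʳ (p v) = *-comm (𝟙 (p v)) (g k)
  ... | no  _ rewrite ∧-zeroʳ (p v) = sym (*-zeroʳ (g k))

-- Graphs, components and the cost of a vertex set

degree : ∀ {n} → Graph n → Fin n → ℕ
degree G i = count (adj G i)

e≡∑∑ : ∀ {n} (G : Graph n) → e G ≡ ∑[ i < n ] ∑[ j < n ] 𝟙 ((toℕ i <ᵇ toℕ j) ∧ adj G i j)
e≡∑∑ {n} G = trans (sum-map-allFin (λ i → List.sum (map (edge i) (allFin n))))
                    (sum-cong-≗ (λ i → sum-map-allFin (edge i)))
  where
  edge : Fin n → Fin n → ℕ
  edge i j = 𝟙 ((toℕ i <ᵇ toℕ j) ∧ adj G i j)

handshake : ∀ {n} (G : Graph n) → ∑[ i < n ] degree G i ≡ 2 * e G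
handshake {n} G = begin
  ∑[ i < n ] ∑[ j < n ] 𝟙 (adj G i j)                   ≡⟨ sum-cong-≗ (λ i → sum-cong-≗ (split i)) ⟩
  ∑[ i < n ] ∑[ j < n ] (forward i j + forward j i)      ≡⟨ sum-cong-≗ (λ i → ∑-distrib-+ (forward i) (λ j → forward j i)) ⟩
  ∑[ i < n ] (∑[ j < n ] forward i j + ∑[ j < n ] forward j i) ≡⟨ ∑-distrib-+ (∑ ∘ forward) (λ i → ∑[ j < n ] forward j i) ⟩
  E + ∑[ i < n ] ∑[ j < n ] forward j i                  ≡⟨ cong (E +_) (∑-comm (λ i j → forward j i)) ⟩
  E + E                                                  ≡⟨ cong (E +_) (+-identityʳ E) ⟨
  2 * E                                                  ≡⟨ cong (2 *_) (e≡∑∑ G) ⟨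
  2 * e G                                                ∎
  where
  open ≡-Reasoning
  forward : Fin n → Fin n → ℕ
  forward i j = 𝟙 ((toℕ i <ᵇ toℕ j) ∧ adj G i j)
  E : ℕ
  E = ∑[ i < n ] ∑[ j < n ] forward i j
  split : ∀ i j → 𝟙 (adj G i j) ≡ forward i j + forward j i
  split i j with <-cmp (toℕ i) (toℕ j)
  ... | tri< i<j _ j≮i rewrite dec-true (toℕ i <? toℕ j) i<j | dec-false (toℕ j <? toℕ i) j≮i =
        sym (+-identityʳ _)
  ... | tri> i≮j _ j<i rewrite dec-false (toℕ i <? toℕ j) i≮j | dec-true (toℕ j <? toℕ i) j<i =
        cong 𝟙 (Graph.sym G i j)
  ... | tri≈ _ i≡j _ rewrite Finₚ.toℕ-injective i≡j | Graph.irrefl G j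
                           | ∧-zeroʳ (toℕ j <ᵇ toℕ j) = refl

𝟙-∧ : ∀ x y → 𝟙 (x ∧ y) ≡ 𝟙 x * 𝟙 y
𝟙-∧ true  y = sym (+-identityʳ (𝟙 y))
𝟙-∧ false y = refl

≤1+2*⌊/2⌋ : ∀ k → k ≤ 1 + 2 * ⌊ k /2⌋
≤1+2*⌊/2⌋ zero          = z≤n
≤1+2*⌊/2⌋ (suc zero)    = ≤-refl
≤1+2*⌊/2⌋ (suc (suc k)) rewrite *-suc 2 ⌊ k /2⌋ = s≤s (s≤s (≤1+2*⌊/2⌋ k))

nontrivial-size≤ : ∀ k → 𝟙 (1 <ᵇ k) * k ≤ 3 * ⌊ k /2⌋
nontrivial-size≤ zero          = z≤n
nontrivial-size≤ (suc zero)    = z≤n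
nontrivial-size≤ (suc (suc k)) = begin
  1 * (2 + k)             ≡⟨ *-identityˡ (2 + k) ⟩
  2 + k                   ≤⟨ +-monoʳ-≤ 2 (≤1+2*⌊/2⌋ k) ⟩
  3 + 2 * ⌊ k /2⌋         ≤⟨ +-monoʳ-≤ 3 (*-monoˡ-≤ ⌊ k /2⌋ (n≤1+n 2)) ⟩
  3 + 3 * ⌊ k /2⌋         ≡⟨ *-suc 3 ⌊ k /2⌋ ⟨
  3 * suc ⌊ k /2⌋         ∎
  where open ≤-Reasoning

𝟙-cover : ∀ a x y u w → (a ≡ true → x ≡ false → y ≡ false → u ≡ true × w ≡ true) →
          𝟙 a ≤ 𝟙 x + 𝟙 y + 𝟙 u * 𝟙 w
𝟙-cover false x     y     u w _ = z≤n
𝟙-cover true  true  y     u w _ = s≤s z≤n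
𝟙-cover true  false true  u w _ = s≤s z≤n
𝟙-cover true  false false u w a∧¬x∧¬y⇒u∧w with refl , refl ← a∧¬x∧¬y⇒u∧w refl refl refl = ≤-refl

𝟙[1<]≤⌊/2⌋ : ∀ k → 𝟙 (1 <ᵇ k) ≤ ⌊ k /2⌋
𝟙[1<]≤⌊/2⌋ zero          = z≤n
𝟙[1<]≤⌊/2⌋ (suc zero)    = z≤n
𝟙[1<]≤⌊/2⌋ (suc (suc k)) = s≤s z≤n

s<⌊/2⌋ : ∀ {x y s} → 3 * s + 2 ≤ x + y → x ≤ s → s < ⌊ y /2⌋
s<⌊/2⌋ {x} {y} {s} n≥3s+2 x≤s = begin
  suc s                        ≡⟨ n≡⌊n+n/2⌋ (suc s) ⟩
  ⌊ suc s + suc s /2⌋          ≤⟨ ⌊n/2⌋-mono (+-cancelʳ-≤ s _ _ (begin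
      suc s + suc s + s             ≡⟨ solve 1 (λ s → (con 1 :+ s) :+ (con 1 :+ s) :+ s := con 3 :* s :+ con 2) refl s ⟩
      3 * s + 2                     ≤⟨ n≥3s+2 ⟩
      x + y                         ≤⟨ +-monoˡ-≤ y x≤s ⟩
      s + y                         ≡⟨ +-comm s y ⟩
      y + s                         ∎)) ⟩
  ⌊ y /2⌋                      ∎
  where open ≤-Reasoning

reach-start∉ : ∀ {n} {G : Graph n} {X u v} → Reach G X u v → u ∉ X
reach-start∉ (here u∉X)     = u∉X
reach-start∉ (step u∉X _ _) = u∉X

reach-end∉ : ∀ {n} {G : Graph n} {X u v} → Reach G X u v → v ∉ X
reach-end∉ (here v∉X)   = v∉X
reach-end∉ (step _ _ r) = reach-end∉ r

inClass : ∀ {n} → Subset n → (Fin n → Fin n) → Fin n → Fin n → Bool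
inClass X c k v = not (lookup X v) ∧ ⌊ c v Fin.≟ k ⌋

classSize≡count : ∀ {n} (X : Subset n) c k → classSize X c k ≡ count (inClass X c k)
classSize≡count X c k = sum-map-allFin (λ v → 𝟙 (inClass X c k v))

cost≡ : ∀ {n} (X : Subset n) c → cost X c ≡ ∣ X ∣ + ∑[ k < n ] ⌊ classSize X c k /2⌋
cost≡ X c = cong (∣ X ∣ +_) (sum-map-allFin (λ k → ⌊ classSize X c k /2⌋))

class≤cost : ∀ {n} (X : Subset n) c k → ∣ X ∣ + ⌊ classSize X c k /2⌋ ≤ cost X c
class≤cost X c k = ≤-trans (+-monoʳ-≤ ∣ X ∣ (term≤∑ (λ k → ⌊ classSize X c k /2⌋) k))
                           (≤-reflexive (sym (cost≡ X c)))

inClass-true : ∀ {n} {X : Subset n} {c k v} → inClass X c k v ≡ true → lookup X v ≡ false × c v ≡ k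
inClass-true {X = X} {c} {k} {v} member with lookup X v | c v Fin.≟ k
... | false | yes cᵥ≡k = refl , cᵥ≡k

nontrivial : ∀ {n} → Subset n → (Fin n → Fin n) → Fin n → Bool
nontrivial X c v = not (lookup X v) ∧ (1 <ᵇ classSize X c (c v))

#nontrivial≤ : ∀ {n} (X : Subset n) c → count (nontrivial X c) ≤ 3 * ∑[ k < n ] ⌊ classSize X c k /2⌋
#nontrivial≤ {n} X c = begin
  count (nontrivial X c)                                     ≡⟨ sum-cong-≗ (λ v → 𝟙-∧ (not (lookup X v)) (1 <ᵇ classSize X c (c v))) ⟩
  ∑[ v < n ] (𝟙 (not (lookup X v)) * large (c v))              ≡⟨ ∑-by-label c (not ∘ lookup X) large ⟩
  ∑[ k < n ] (large k * count (inClass X c k))                 ≡⟨ sum-cong-≗ (λ k → cong (large k *_) (classSize≡count X c k)) ⟨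
  ∑[ k < n ] (large k * classSize X c k)                       ≤⟨ ∑-mono-≤ (λ k → nontrivial-size≤ (classSize X c k)) ⟩
  ∑[ k < n ] (3 * ⌊ classSize X c k /2⌋)                     ≡⟨ *-distribˡ-sum 3 (λ k → ⌊ classSize X c k /2⌋) ⟨
  3 * ∑[ k < n ] ⌊ classSize X c k /2⌋                       ∎
  where
  open ≤-Reasoning
  large : Fin n → ℕ
  large k = 𝟙 (1 <ᵇ classSize X c k)

module _ {n} {G : Graph n} {X : Subset n} {c : Fin n → Fin n} (lab : IsComponentLabelling G X c) where

  reach⇒same-class : ∀ {u v} → Reach G X u v → c u ≡ c v
  reach⇒same-class r = Equivalence.from (lab _ _ (reach-start∉ r) (reach-end∉ r)) r

  edge⇒class≥2 : ∀ {i j} → Adj G i j → lookup X i ≡ false → lookup X j ≡ false → 2 ≤ classSize X c (c i)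
  edge⇒class≥2 {i} {j} aᵢⱼ Xᵢ Xⱼ = subst (2 ≤_) (sym (classSize≡count X c (c i)))
    (distinct≤count _ (i ∷ j ∷ []) ((i≢j ∷ []) ∷ [] ∷ []) (member Xᵢ refl ∷ member Xⱼ (sym cᵢ≡cⱼ) ∷ []))
    where
    i≢j : i ≢ j
    i≢j refl with () ← trans (sym aᵢⱼ) (Graph.irrefl G i)
    cᵢ≡cⱼ : c i ≡ c j
    cᵢ≡cⱼ = reach⇒same-class (step (lookup≡false⇒∉ Xᵢ) aᵢⱼ (here (lookup≡false⇒∉ Xⱼ)))
    member : ∀ {v} → lookup X v ≡ false → c v ≡ c i → inClass X c (c i) v ≡ true
    member Xᵥ cᵥ = cong₂ (λ x y → not x ∧ y) Xᵥ (⌊⌋-true (_ Fin.≟ _) cᵥ)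

  edge⇒nontrivial : ∀ {i j} → Adj G i j → lookup X i ≡ false → lookup X j ≡ false →
                    nontrivial X c i ≡ true
  edge⇒nontrivial {i} aᵢⱼ Xᵢ Xⱼ =
    cong₂ (λ x y → not x ∧ y) Xᵢ (dec-true (1 <? classSize X c (c i)) (edge⇒class≥2 aᵢⱼ Xᵢ Xⱼ))

  dominating-class : ∀ {k} → k ∉ X → (∀ v → v ∉ X → v ≢ k → Adj G v k) →
                     classSize X c (c k) ≡ count (not ∘ lookup X)
  dominating-class {k} k∉X dominates = trans (classSize≡count X c (c k)) (sum-cong-≗ joins)
    where
    joins : ∀ v → 𝟙 (inClass X c (c k) v) ≡ 𝟙 (not (lookup X v))
    joins v with lookup X v in Xᵥ
    ... | true  = refl
    ... | false = cong 𝟙 (⌊⌋-true (c v Fin.≟ c k) (reach⇒same-class reach))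
      where
      reach : Reach G X v k
      reach with v Fin.≟ k
      ... | yes refl = here k∉X
      ... | no  v≢k  = step (lookup≡false⇒∉ Xᵥ) (dominates v (lookup≡false⇒∉ Xᵥ) v≢k) (here k∉X)

  edge-cover : ∀ i j → 𝟙 (adj G i j) ≤
               𝟙 (lookup X i) + 𝟙 (lookup X j) + 𝟙 (nontrivial X c i) * 𝟙 (nontrivial X c j)
  edge-cover i j = 𝟙-cover (adj G i j) (lookup X i) (lookup X j) _ _ λ aᵢⱼ Xᵢ Xⱼ →
    edge⇒nontrivial aᵢⱼ Xᵢ Xⱼ , edge⇒nontrivial (trans (Graph.sym G j i) aᵢⱼ) Xⱼ Xᵢ

  private
    W : Fin n → Bool
    W = nontrivial X c

  degree≤ : ∀ i → degree G i ≤ n * 𝟙 (lookup X i) + count (lookup X) + 𝟙 (W i) * count W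
  degree≤ i = begin
    degree G i                                                          ≤⟨ ∑-mono-≤ (edge-cover i) ⟩
    ∑[ j < n ] (𝟙 (lookup X i) + 𝟙 (lookup X j) + 𝟙 (W i) * 𝟙 (W j))    ≡⟨ ∑-distrib-+ (λ j → 𝟙 (lookup X i) + 𝟙 (lookup X j)) (λ j → 𝟙 (W i) * 𝟙 (W j)) ⟩
    ∑[ j < n ] (𝟙 (lookup X i) + 𝟙 (lookup X j)) + ∑[ j < n ] (𝟙 (W i) * 𝟙 (W j))
      ≡⟨ cong₂ _+_ (∑-distrib-+ (λ _ → 𝟙 (lookup X i)) (𝟙 ∘ lookup X)) (sym (*-distribˡ-sum (𝟙 (W i)) (𝟙 ∘ W))) ⟩
    ∑[ j < n ] 𝟙 (lookup X i) + count (lookup X) + 𝟙 (W i) * count W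
      ≡⟨ cong (λ z → z + count (lookup X) + 𝟙 (W i) * count W) (∑-const n (𝟙 (lookup X i))) ⟩
    n * 𝟙 (lookup X i) + count (lookup X) + 𝟙 (W i) * count W           ∎
    where open ≤-Reasoning

  2e≤2n∣X∣+∣W∣² : 2 * e G ≤ 2 * (n * ∣ X ∣) + count W * count W
  2e≤2n∣X∣+∣W∣² = begin
    2 * e G                                                             ≡⟨ handshake G ⟨
    ∑[ i < n ] degree G i                                               ≤⟨ ∑-mono-≤ degree≤ ⟩
    ∑[ i < n ] (n * 𝟙 (lookup X i) + count (lookup X) + 𝟙 (W i) * count W)
      ≡⟨ ∑-distrib-+ (λ i → n * 𝟙 (lookup X i) + count (lookup X)) (λ i → 𝟙 (W i) * count W) ⟩
    ∑[ i < n ] (n * 𝟙 (lookup X i) + count (lookup X)) + ∑[ i < n ] (𝟙 (W i) * count W)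
      ≡⟨ cong₂ _+_ (∑-distrib-+ (λ i → n * 𝟙 (lookup X i)) (λ _ → count (lookup X)))
                   (sym (*-distribʳ-sum (count W) (𝟙 ∘ W))) ⟩
    ∑[ i < n ] (n * 𝟙 (lookup X i)) + ∑[ i < n ] count (lookup X) + count W * count W
      ≡⟨ cong₂ (λ y z → y + z + count W * count W) (sym (*-distribˡ-sum n (𝟙 ∘ lookup X))) (∑-const n _) ⟩
    n * count (lookup X) + n * count (lookup X) + count W * count W
      ≡⟨ cong (λ z → n * count (lookup X) + z + count W * count W) (+-identityʳ (n * count (lookup X))) ⟨
    2 * (n * count (lookup X)) + count W * count W
      ≡⟨ cong (λ z → 2 * (n * z) + count W * count W) (∣∣≡count X) ⟨
    2 * (n * ∣ X ∣) + count W * count W                                 ∎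
    where open ≤-Reasoning

2e≤2n∣X∣+[3s]² : ∀ {n} s (G : Graph n) (X : Subset n) → InXset s G X →
             2 * e G ≤ 2 * (n * ∣ X ∣) + (3 * s) * (3 * s)
2e≤2n∣X∣+[3s]² s G X (c , lab , cost≤s) = ≤-trans (2e≤2n∣X∣+∣W∣² lab) (+-monoʳ-≤ _ (*-mono-≤ W≤3s W≤3s))
  where
  W≤3s : count (nontrivial X c) ≤ 3 * s
  W≤3s = ≤-trans (#nontrivial≤ X c)
           (*-monoʳ-≤ 3 (≤-trans (m≤n+m _ ∣ X ∣) (≤-trans (≤-reflexive (sym (cost≡ X c))) cost≤s)))

-- Arithmetic

kC2*2+k≡k*k : ∀ k → (k C 2) * 2 + k ≡ k * k
kC2*2+k≡k*k zero    = refl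
kC2*2+k≡k*k (suc k) = begin
  (suc k C 2) * 2 + suc k      ≡⟨ cong (λ c → c * 2 + suc k) pascal ⟨
  (k + k C 2) * 2 + suc k      ≡⟨ solve 2 (λ k c → (k :+ c) :* con 2 :+ (con 1 :+ k) := (c :* con 2 :+ k) :+ (con 1 :+ con 2 :* k)) refl k (k C 2) ⟩
  (k C 2) * 2 + k + suc (2 * k) ≡⟨ cong (_+ suc (2 * k)) (kC2*2+k≡k*k k) ⟩
  k * k + suc (2 * k)          ≡⟨ solve 1 (λ k → k :* k :+ (con 1 :+ con 2 :* k) := (con 1 :+ k) :* (con 1 :+ k)) refl k ⟩
  suc k * suc k                ∎
  where
  open ≡-Reasoning
  pascal : k + k C 2 ≡ suc k C 2
  pascal = trans (cong (_+ k C 2) (sym (nC1≡n k))) (nCk+nC[k+1]≡[n+1]C[k+1] k 1)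

3s+2≤2*[3sC2] : ∀ {s} → 1 ≤ s → 3 * s + 2 ≤ 2 * ((3 * s) C 2)
3s+2≤2*[3sC2] {s} 1≤s = +-cancelʳ-≤ (3 * s) _ _ (begin
  3 * s + 2 + 3 * s                    ≤⟨ +-monoˡ-≤ (3 * s) (+-monoʳ-≤ (3 * s) (*-monoʳ-≤ 2 1≤s)) ⟩
  3 * s + 2 * s + 3 * s                ≡⟨ solve 1 (λ s → con 3 :* s :+ con 2 :* s :+ con 3 :* s := con 8 :* s) refl s ⟩
  8 * s                                ≤⟨ *-monoʳ-≤ 8 (m≤m*n s s) ⟩
  8 * (s * s)                          ≤⟨ *-monoˡ-≤ (s * s) (n≤1+n 8) ⟩
  9 * (s * s)                          ≡⟨ solve 1 (λ s → con 9 :* (s :* s) := (con 3 :* s) :* (con 3 :* s)) refl s ⟩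
  (3 * s) * (3 * s)                    ≡⟨ kC2*2+k≡k*k (3 * s) ⟨
  ((3 * s) C 2) * 2 + 3 * s            ≡⟨ cong (_+ 3 * s) (*-comm ((3 * s) C 2) 2) ⟩
  2 * ((3 * s) C 2) + 3 * s            ∎)
  where
  open ≤-Reasoning
  instance
    s≢0 : NonZero s
    s≢0 = >-nonZero 1≤s

-- Lowering x to a - 1 frees 2(a + b) ≥ 18s² - 6s, which pays for 2a² + 9s² ≤ 11s².
2[a+b]x+9s²≤2ab : ∀ {a b x s} → x < a → a ≤ s → 2 * ((3 * s) C 2) ≤ a + b →
                  2 * ((a + b) * x) + (3 * s) * (3 * s) ≤ 2 * (a * b)
2[a+b]x+9s²≤2ab {a} {b} {x} {s} x<a a≤s big = +-cancelʳ-≤ (2 * (a + b)) _ _ (begin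
  2 * ((a + b) * x) + S + 2 * (a + b)  ≡⟨ solve 4 (λ a b x S → con 2 :* ((a :+ b) :* x) :+ S :+ con 2 :* (a :+ b)
                                                            := con 2 :* ((a :+ b) :* (con 1 :+ x)) :+ S) refl a b x S ⟩
  2 * ((a + b) * suc x) + S            ≤⟨ +-monoˡ-≤ S (*-monoʳ-≤ 2 (*-monoʳ-≤ (a + b) x<a)) ⟩
  2 * ((a + b) * a) + S                ≡⟨ solve 3 (λ a b S → con 2 :* ((a :+ b) :* a) :+ S := con 2 :* (a :* b) :+ (con 2 :* (a :* a) :+ S)) refl a b S ⟩
  2 * (a * b) + (2 * (a * a) + S)      ≤⟨ +-monoʳ-≤ (2 * (a * b)) (+-cancelʳ-≤ (6 * s) _ _ squares≤) ⟩
  2 * (a * b) + 2 * (a + b)            ∎)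
  where
  open ≤-Reasoning
  S : ℕ
  S = (3 * s) * (3 * s)
  instance
    s≢0 : NonZero s
    s≢0 = >-nonZero (≤-trans (s≤s z≤n) (≤-trans x<a a≤s))
  squares≤ : 2 * (a * a) + S + 6 * s ≤ 2 * (a + b) + 6 * s
  squares≤ = begin
    2 * (a * a) + S + 6 * s              ≤⟨ +-mono-≤ (+-monoˡ-≤ S (*-monoʳ-≤ 2 (*-mono-≤ a≤s a≤s))) (*-monoʳ-≤ 6 (m≤m*n s s)) ⟩
    2 * (s * s) + S + 6 * (s * s)        ≤⟨ +-monoʳ-≤ (2 * (s * s) + S) (*-monoˡ-≤ (s * s) (n≤1+n 6)) ⟩
    2 * (s * s) + S + 7 * (s * s)        ≡⟨ solve 1 (λ s → con 2 :* (s :* s) :+ (con 3 :* s) :* (con 3 :* s) :+ con 7 :* (s :* s)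
                                                          := con 2 :* ((con 3 :* s) :* (con 3 :* s))) refl s ⟩
    2 * S                                ≡⟨ cong (2 *_) (kC2*2+k≡k*k (3 * s)) ⟨
    2 * (((3 * s) C 2) * 2 + 3 * s)      ≡⟨ solve 2 (λ c s → con 2 :* (c :* con 2 :+ con 3 :* s) := con 2 :* (con 2 :* c) :+ con 6 :* s) refl ((3 * s) C 2) s ⟩
    2 * (2 * ((3 * s) C 2)) + 6 * s      ≤⟨ +-monoˡ-≤ (6 * s) (*-monoʳ-≤ 2 big) ⟩
    2 * (a + b) + 6 * s                  ∎

-- The extremal graph

-- Vertex v < a is an apex, vertex a + (r + 3τ) with r < 3 and τ < m is corner r of triangle τ,
-- and all further vertices are isolated.
module Extremal (a m n : ℕ) where

  Apex : Fin n → Set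
  Apex v = toℕ v < a

  apex? : ∀ v → Dec (Apex v)
  apex? v = toℕ v <? a

  triangle : Fin n → ℕ
  triangle v = (toℕ v ∸ a) / 3

  position : Fin n → ℕ
  position v = (toℕ v ∸ a) % 3

  Triangular : Fin n → Set
  Triangular v = a ≤ toℕ v × triangle v < m

  triangular? : ∀ v → Dec (Triangular v)
  triangular? v = (a ≤? toℕ v) ×-dec (triangle v <? m)

  OnTriangle : ℕ → Fin n → Set
  OnTriangle τ v = Triangular v × triangle v ≡ τ

  onTriangle? : ∀ τ v → Dec (OnTriangle τ v)
  onTriangle? τ v = triangular? v ×-dec (triangle v ≟ τ)

  SameTriangle : Fin n → Fin n → Set
  SameTriangle u v = Triangular u × Triangular v × triangle u ≡ triangle v

  sameTriangle? : ∀ u v → Dec (SameTriangle u v)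
  sameTriangle? u v = triangular? u ×-dec triangular? v ×-dec (triangle u ≟ triangle v)

  Adjacent : Fin n → Fin n → Set
  Adjacent u v = u ≢ v × (Apex u ⊎ Apex v ⊎ SameTriangle u v)

  adjacent? : ∀ u v → Dec (Adjacent u v)
  adjacent? u v = ¬? (u Fin.≟ v) ×-dec (apex? u ⊎-dec apex? v ⊎-dec sameTriangle? u v)

  Adjacent-sym : ∀ {u v} → Adjacent u v → Adjacent v u
  Adjacent-sym (u≢v , inj₁ au)                   = u≢v ∘ sym , inj₂ (inj₁ au)
  Adjacent-sym (u≢v , inj₂ (inj₁ av))            = u≢v ∘ sym , inj₁ av
  Adjacent-sym (u≢v , inj₂ (inj₂ (tu , tv , e))) = u≢v ∘ sym , inj₂ (inj₂ (tv , tu , sym e))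

  H : Graph n
  H = record
    { adj    = λ u v → does (adjacent? u v)
    ; sym    = λ u v → does-⇔ (mk⇔ Adjacent-sym Adjacent-sym) (adjacent? u v) (adjacent? v u)
    ; irrefl = λ v → dec-false (adjacent? v v) (λ (v≢v , _) → v≢v refl)
    }

  Adj⇒Adjacent : ∀ {u v} → Adj H u v → Adjacent u v
  Adj⇒Adjacent = witness (adjacent? _ _)

  Adjacent⇒Adj : ∀ {u v} → Adjacent u v → Adj H u v
  Adjacent⇒Adj = dec-true (adjacent? _ _)

  edge-without-apex : ∀ {u v} → Adj H u v → ¬ Apex u → ¬ Apex v → SameTriangle u v
  edge-without-apex uv ¬au ¬av with Adj⇒Adjacent uv
  ... | _ , inj₁ au          = contradiction au ¬au
  ... | _ , inj₂ (inj₁ av)   = contradiction av ¬av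
  ... | _ , inj₂ (inj₂ same) = same

  decompose : ∀ {v} → a ≤ toℕ v → toℕ v ≡ a + (position v + triangle v * 3)
  decompose {v} a≤v = trans (sym (m+[n∸m]≡n a≤v)) (cong (a +_) (m≡m%n+[m/n]*n (toℕ v ∸ a) 3))

  coordinates : ∀ {v} τ r → r < 3 → toℕ v ≡ a + (r + τ * 3) →
                a ≤ toℕ v × triangle v ≡ τ × position v ≡ r
  coordinates {v} τ r r<3 v≡ = a≤v , triangle≡ , position≡
    where
    a≤v : a ≤ toℕ v
    a≤v = subst (a ≤_) (sym v≡) (m≤m+n a _)
    offset : toℕ v ∸ a ≡ r + τ * 3
    offset = trans (cong (_∸ a) v≡) (m+n∸m≡n a _)
    triangle≡ : triangle v ≡ τ
    triangle≡ = begin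
      (toℕ v ∸ a) / 3         ≡⟨ cong (_/ 3) offset ⟩
      (r + τ * 3) / 3         ≡⟨ +-distrib-/-∣ʳ r (divides τ refl) ⟩
      r / 3 + τ * 3 / 3       ≡⟨ cong₂ _+_ (m<n⇒m/n≡0 r<3) (m*n/n≡m τ 3) ⟩
      τ                       ∎
      where open ≡-Reasoning
    position≡ : position v ≡ r
    position≡ = trans (cong (_% 3) offset) (trans ([m+kn]%n≡m%n r τ 3) (m<n⇒m%n≡m r<3))

  on-triangle-injective : ∀ {τ u v} → OnTriangle τ u → OnTriangle τ v → position u ≡ position v → u ≡ v
  on-triangle-injective ((a≤u , _) , tu) ((a≤v , _) , tv) pos = Finₚ.toℕ-injective (begin
    toℕ _                                   ≡⟨ decompose a≤u ⟩
    a + (position _ + triangle _ * 3)       ≡⟨ cong₂ (λ p t → a + (p + t * 3)) pos (trans tu (sym tv)) ⟩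
    a + (position _ + triangle _ * 3)       ≡⟨ decompose a≤v ⟨
    toℕ _                                   ∎)
    where open ≡-Reasoning

  #apex≤a : count (does ∘ apex?) ≤ a
  #apex≤a = count≤code-bound a (does ∘ apex?) toℕ (λ v → witness (apex? v)) (λ _ _ _ _ → Finₚ.toℕ-injective)

  #apex≡a : a ≤ n → count (does ∘ apex?) ≡ a
  #apex≡a a≤n = ≤-antisym #apex≤a (injection≤count (does ∘ apex?) (λ i → Fin.inject≤ i a≤n) apex-inject
                                      (Finₚ.inject≤-injective a≤n a≤n))
    where
    apex-inject : ∀ i → does (apex? (Fin.inject≤ i a≤n)) ≡ true
    apex-inject i = dec-true (apex? _) (subst (_< a) (sym (Finₚ.toℕ-inject≤ i a≤n)) (Finₚ.toℕ<n i))

  #onTriangle≤3 : ∀ τ → count (does ∘ onTriangle? τ) ≤ 3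
  #onTriangle≤3 τ = count≤code-bound 3 (does ∘ onTriangle? τ) position (λ v _ → m%n<n (toℕ v ∸ a) 3)
    (λ u v ou ov → on-triangle-injective (witness (onTriangle? τ u) ou) (witness (onTriangle? τ v) ov))

  apex-family≤a : ∀ {k} (f : Fin k → Fin n) → (∀ i j → f i ≡ f j → i ≡ j) → (∀ i → Apex (f i)) → k ≤ a
  apex-family≤a f f-inj all-apex =
    ≤-trans (injection≤count (does ∘ apex?) f (λ i → dec-true (apex? (f i)) (all-apex i)) f-inj) #apex≤a

  non-apex-member : ∀ {k} (f : Fin k → Fin n) → (∀ i j → f i ≡ f j → i ≡ j) → a < k → ∃ λ i → ¬ Apex (f i)
  non-apex-member f f-inj a<k =
    Finₚ.¬∀⟶∃¬ _ _ (apex? ∘ f) (λ all-apex → <⇒≱ a<k (apex-family≤a f f-inj all-apex))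

  apex-or-on-triangle : ∀ {τ v} → Apex v ⊎ OnTriangle τ v → does (apex? v) ∨ does (onTriangle? τ v) ≡ true
  apex-or-on-triangle {τ} {v} (inj₁ av) rewrite dec-true (apex? v) av = refl
  apex-or-on-triangle {τ} {v} (inj₂ ov) rewrite dec-true (onTriangle? τ v) ov = ∨-zeroʳ _

  -- Two non-apex vertices on opposite sides lie on a common triangle, and every other vertex
  -- is adjacent to one of them.
  bipartite-covered : ∀ {l t} (f : Fin (l + t) → Fin n) → (∀ i j → Adj H (f (i ↑ˡ t)) (f (l ↑ʳ j))) →
                      ∀ {i₀ j₀} → ¬ Apex (f (i₀ ↑ˡ t)) → ¬ Apex (f (l ↑ʳ j₀)) →
                      ∀ p → Apex (f p) ⊎ OnTriangle (triangle (f (l ↑ʳ j₀))) (f p)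
  bipartite-covered {l} {t} f complete {i₀} {j₀} ¬a₀ ¬b₀ p with ↑-view l p
  ... | inj₁ (i , refl) with apex? (f (i ↑ˡ t))
  ...   | yes ai  = inj₁ ai
  ...   | no  ¬ai with tᵢ , _ , e ← edge-without-apex (complete i j₀) ¬ai ¬b₀ = inj₂ (tᵢ , e)
  bipartite-covered {l} {t} f complete {i₀} {j₀} ¬a₀ ¬b₀ p | inj₂ (j , refl) with apex? (f (l ↑ʳ j))
  ...   | yes bj  = inj₁ bj
  ...   | no  ¬bj with _ , tⱼ , e ← edge-without-apex (complete i₀ j) ¬a₀ ¬bj
                     | _ , _ , e₀ ← edge-without-apex (complete i₀ j₀) ¬a₀ ¬b₀ = inj₂ (tⱼ , trans (sym e) e₀)

  bipartite≤a+3 : ∀ {t} (f : Fin (suc a + t) → Fin n) → (∀ p q → f p ≡ f q → p ≡ q) →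
                  (∀ i j → Adj H (f (i ↑ˡ t)) (f (suc a ↑ʳ j))) →
                  ∀ i₀ j₀ → ¬ Apex (f (i₀ ↑ˡ t)) → ¬ Apex (f (suc a ↑ʳ j₀)) → suc a + t ≤ a + 3
  bipartite≤a+3 {t} f f-inj complete i₀ j₀ ¬a₀ ¬b₀ = begin
    suc a + t                 ≤⟨ injection≤count apex-or-τ f (apex-or-on-triangle ∘ bipartite-covered f complete ¬a₀ ¬b₀) f-inj ⟩
    count apex-or-τ           ≤⟨ count-∨ (does ∘ apex?) (does ∘ onTriangle? τ) ⟩
    count (does ∘ apex?) + count (does ∘ onTriangle? τ) ≤⟨ +-mono-≤ #apex≤a (#onTriangle≤3 τ) ⟩
    a + 3                     ∎
    where
    open ≤-Reasoning
    τ : ℕ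
    τ = triangle (f (suc a ↑ʳ j₀))
    apex-or-τ : Fin n → Bool
    apex-or-τ v = does (apex? v) ∨ does (onTriangle? τ v)

  K-free : ∀ t → 3 ≤ t → a < t → ContainsK (suc a) t H → ⊥
  K-free t 3≤t a<t (f , f-inj , complete) =
    <⇒≱ (+-monoʳ-≤ (suc a) 3≤t) (bipartite≤a+3 f (λ _ _ → f-inj) complete (proj₁ A∖apex) (proj₁ B∖apex) (proj₂ A∖apex) (proj₂ B∖apex))
    where
    A∖apex : ∃ λ i → ¬ Apex (f (i ↑ˡ t))
    A∖apex = non-apex-member (λ i → f (i ↑ˡ t)) (λ i j e → Finₚ.↑ˡ-injective t i j (f-inj e)) ≤-refl
    B∖apex : ∃ λ j → ¬ Apex (f (suc a ↑ʳ j))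
    B∖apex = non-apex-member (λ j → f (suc a ↑ʳ j)) (λ i j e → Finₚ.↑ʳ-injective (suc a) i j (f-inj e)) a<t

  four-on-triangle : ∀ {τ} (vs : Vec (Fin n) 4) → Unique vs → All (OnTriangle τ) vs → ⊥
  four-on-triangle {τ} vs distinct on-τ = <-irrefl refl (≤-trans
    (distinct≤count (does ∘ onTriangle? τ) vs distinct (All.map (dec-true (onTriangle? τ _)) on-τ))
    (#onTriangle≤3 τ))

  -- Each edge of a matching either has an apex endpoint or lies inside a triangle, and a
  -- triangle cannot contain two disjoint edges; so a matching has at most a + m edges.
  module _ {M} (f : Fin (M + M) → Fin n) (f-inj : ∀ {p q} → f p ≡ f q → p ≡ q)
           (matched : ∀ i → Adj H (f (i ↑ˡ M)) (f (M ↑ʳ i))) where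

    private
      left : Fin M → Fin n
      left i = f (i ↑ˡ M)

      right : Fin M → Fin n
      right i = f (M ↑ʳ i)

      Endpoint : Fin M → Fin (M + M) → Set
      Endpoint i p = p ≡ i ↑ˡ M ⊎ p ≡ M ↑ʳ i

      endpoint-injective : ∀ {i j p} → Endpoint i p → Endpoint j p → i ≡ j
      endpoint-injective (inj₁ refl) (inj₁ e) = Finₚ.↑ˡ-injective M _ _ e
      endpoint-injective (inj₁ refl) (inj₂ e) = ⊥-elim (↑ˡ≢↑ʳ _ _ e)
      endpoint-injective (inj₂ refl) (inj₁ e) = ⊥-elim (↑ˡ≢↑ʳ _ _ (sym e))
      endpoint-injective (inj₂ refl) (inj₂ e) = Finₚ.↑ʳ-injective M _ _ e

      Cover : Fin M → Set
      Cover i = (∃ λ p → Endpoint i p × Apex (f p)) ⊎ SameTriangle (left i) (right i)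

      cover : ∀ i → Cover i
      cover i with apex? (left i) | apex? (right i)
      ... | yes al | _      = inj₁ (i ↑ˡ M , inj₁ refl , al)
      ... | no _   | yes ar = inj₁ (M ↑ʳ i , inj₂ refl , ar)
      ... | no ¬al | no ¬ar = inj₂ (edge-without-apex (matched i) ¬al ¬ar)

      code : ∀ {i} → Cover i → ℕ
      code     (inj₁ (p , _)) = toℕ (f p)
      code {i} (inj₂ _)       = a + triangle (left i)

      code<a+m : ∀ {i} (c : Cover i) → code c < a + m
      code<a+m (inj₁ (_ , _ , ap)) = ≤-trans ap (m≤m+n a m)
      code<a+m (inj₂ (tl , _ , _)) = +-monoʳ-< a (proj₂ tl)

      disjoint-edges : ∀ {i j} → i ≢ j → SameTriangle (left i) (right i) → SameTriangle (left j) (right j) →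
                       triangle (left i) ≢ triangle (left j)
      disjoint-edges {i} {j} i≢j (tlᵢ , trᵢ , eᵢ) (tlⱼ , trⱼ , eⱼ) τᵢ≡τⱼ =
        four-on-triangle (left i ∷ right i ∷ left j ∷ right j ∷ []) distinct-ends
          ((tlᵢ , refl) ∷ (trᵢ , sym eᵢ) ∷ (tlⱼ , sym τᵢ≡τⱼ) ∷ (trⱼ , trans (sym eⱼ) (sym τᵢ≡τⱼ)) ∷ [])
        where
        distinct-ends : Unique (left i ∷ right i ∷ left j ∷ right j ∷ [])
        distinct-ends = ( (λ e → ↑ˡ≢↑ʳ i i (f-inj e))
                        ∷ (λ e → i≢j (Finₚ.↑ˡ-injective M i j (f-inj e)))
                        ∷ (λ e → ↑ˡ≢↑ʳ i j (f-inj e)) ∷ [])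
                      ∷ ( (λ e → ↑ˡ≢↑ʳ j i (sym (f-inj e)))
                        ∷ (λ e → i≢j (Finₚ.↑ʳ-injective M i j (f-inj e))) ∷ [])
                      ∷ ((λ e → ↑ˡ≢↑ʳ j j (f-inj e)) ∷ [])
                      ∷ [] ∷ []

      code-injective : ∀ {i j} (cᵢ : Cover i) (cⱼ : Cover j) → code cᵢ ≡ code cⱼ → i ≡ j
      code-injective (inj₁ (p , eᵢ , _)) (inj₁ (q , eⱼ , _)) e
        with refl ← f-inj (Finₚ.toℕ-injective e) = endpoint-injective eᵢ eⱼ
      code-injective (inj₁ (_ , _ , ap)) (inj₂ _) e = ⊥-elim (<⇒≱ ap (subst (a ≤_) (sym e) (m≤m+n a _)))
      code-injective (inj₂ _) (inj₁ (_ , _ , aq)) e = ⊥-elim (<⇒≱ aq (subst (a ≤_) e (m≤m+n a _)))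
      code-injective {i} {j} (inj₂ sᵢ) (inj₂ sⱼ) e with i Fin.≟ j
      ... | yes i≡j = i≡j
      ... | no  i≢j = ⊥-elim (disjoint-edges i≢j sᵢ sⱼ (+-cancelˡ-≡ a _ _ e))

    matching≤a+m : M ≤ a + m
    matching≤a+m = begin
      M                       ≡⟨ count-true M ⟨
      count {M} (λ _ → true)  ≤⟨ count≤code-bound (a + m) (λ _ → true) (code ∘ cover)
                                   (λ i _ → code<a+m (cover i)) (λ i j _ _ → code-injective (cover i) (cover j)) ⟩
      a + m                   ∎
      where open ≤-Reasoning

  M-free : ContainsM (suc (a + m)) H → ⊥
  M-free (f , f-inj , matched) = <-irrefl refl (matching≤a+m f f-inj matched)

  apexes : Subset n
  apexes = Vec.tabulate (does ∘ apex?)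

  ∉apexes⇒¬Apex : ∀ {v} → v ∉ apexes → ¬ Apex v
  ∉apexes⇒¬Apex {v} v∉A av with () ← trans (sym (∉⇒lookup≡false v∉A)) (trans (lookup∘tabulate (does ∘ apex?) v) (dec-true (apex? v) av))

  ∣apexes∣≡a : a ≤ n → ∣ apexes ∣ ≡ a
  ∣apexes∣≡a a≤n = trans (∣∣≡count apexes) (trans (sum-cong-≗ (cong 𝟙 ∘ lookup∘tabulate (does ∘ apex?))) (#apex≡a a≤n))

  leaderℕ : Fin n → ℕ
  leaderℕ v with triangular? v
  ... | yes _ = a + triangle v * 3
  ... | no  _ = toℕ v

  leaderℕ≤ : ∀ v → leaderℕ v ≤ toℕ v
  leaderℕ≤ v with triangular? v
  ... | yes (a≤v , _) = subst (a + triangle v * 3 ≤_) (sym (decompose a≤v)) (+-monoʳ-≤ a (m≤n+m (triangle v * 3) (position v)))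
  ... | no  _         = ≤-refl

  -- Labels the components of H - apexes: a triangle by its corner at position 0, any other vertex by itself.
  leader : Fin n → Fin n
  leader v = fromℕ< (≤-<-trans (leaderℕ≤ v) (Finₚ.toℕ<n v))

  IsLeader : Fin n → Set
  IsLeader k = Triangular k × position k ≡ 0

  isLeader? : ∀ k → Dec (IsLeader k)
  isLeader? k = triangular? k ×-dec (position k ≟ 0)

  toℕ-leader : ∀ v → toℕ (leader v) ≡ leaderℕ v
  toℕ-leader v = Finₚ.toℕ-fromℕ< _

  leader-fixed : ∀ {v} → ¬ Triangular v → leader v ≡ v
  leader-fixed {v} ¬tv = Finₚ.toℕ-injective (trans (toℕ-leader v) fixed)
    where
    fixed : leaderℕ v ≡ toℕ v
    fixed with triangular? v
    ... | yes tv = contradiction tv ¬tv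
    ... | no  _  = refl

  leaderℕ-triangular : ∀ {v} → Triangular v → leaderℕ v ≡ a + triangle v * 3
  leaderℕ-triangular {v} tv with triangular? v
  ... | yes _  = refl
  ... | no ¬tv = contradiction tv ¬tv

  leader-triangular : ∀ {v} → Triangular v → IsLeader (leader v) × triangle (leader v) ≡ triangle v
  leader-triangular {v} tv@(_ , τ<m)
    with a≤ℓ , τℓ≡τ , pos≡0 ← coordinates (triangle v) 0 (s≤s z≤n) (trans (toℕ-leader v) (leaderℕ-triangular tv)) =
    ((a≤ℓ , subst (_< m) (sym τℓ≡τ) τ<m) , pos≡0) , τℓ≡τ

  leaders-injective : ∀ {k l} → IsLeader k → IsLeader l → triangle k ≡ triangle l → k ≡ l
  leaders-injective (tk , pk) (tl , pl) τₖ≡τₗ = on-triangle-injective (tk , refl) (tl , sym τₖ≡τₗ) (trans pk (sym pl))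

  same-triangle⇒same-leader : ∀ {u v} → SameTriangle u v → leader u ≡ leader v
  same-triangle⇒same-leader (tu , tv , τᵤ≡τᵥ) =
    leaders-injective (proj₁ (leader-triangular tu)) (proj₁ (leader-triangular tv))
      (trans (proj₂ (leader-triangular tu)) (trans τᵤ≡τᵥ (sym (proj₂ (leader-triangular tv)))))

  reach⇒same-leader : ∀ {u v} → Reach H apexes u v → leader u ≡ leader v
  reach⇒same-leader (here _)         = refl
  reach⇒same-leader (step u∉A uw r) =
    trans (same-triangle⇒same-leader (edge-without-apex uw (∉apexes⇒¬Apex u∉A) (∉apexes⇒¬Apex (reach-start∉ r))))
          (reach⇒same-leader r)

  apex-labelling : IsComponentLabelling H apexes leader
  apex-labelling u v u∉A v∉A = mk⇔ same-leader⇒reach reach⇒same-leader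
    where
    same-leader⇒reach : leader u ≡ leader v → Reach H apexes u v
    same-leader⇒reach ℓ≡ = by-cases (triangular? u) (triangular? v)
      where
      by-cases : Dec (Triangular u) → Dec (Triangular v) → Reach H apexes u v
      by-cases (yes tu) (yes tv) with u Fin.≟ v
      ... | yes u≡v = subst (Reach H apexes u) u≡v (here u∉A)
      ... | no  u≢v = step u∉A (Adjacent⇒Adj (u≢v , inj₂ (inj₂ (tu , tv , τ≡)))) (here v∉A)
        where
        τ≡ : triangle u ≡ triangle v
        τ≡ = trans (sym (proj₂ (leader-triangular tu))) (trans (cong triangle ℓ≡) (proj₂ (leader-triangular tv)))
      by-cases (yes tu) (no ¬tv) =
        contradiction (subst Triangular (trans ℓ≡ (leader-fixed ¬tv)) (proj₁ (proj₁ (leader-triangular tu)))) ¬tv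
      by-cases (no ¬tu) (yes tv) =
        contradiction (subst Triangular (trans (sym ℓ≡) (leader-fixed ¬tu)) (proj₁ (proj₁ (leader-triangular tv)))) ¬tu
      by-cases (no ¬tu) (no ¬tv) =
        subst (Reach H apexes u) (trans (sym (leader-fixed ¬tu)) (trans ℓ≡ (leader-fixed ¬tv))) (here u∉A)

  #leaders≤m : count (does ∘ isLeader?) ≤ m
  #leaders≤m = count≤code-bound m (does ∘ isLeader?) triangle
    (λ k lk → proj₂ (proj₁ (witness (isLeader? k) lk)))
    (λ k l lk ll → leaders-injective (witness (isLeader? k) lk) (witness (isLeader? l) ll))

  class-of-leader≤3 : ∀ {k} → IsLeader k → classSize apexes leader k ≤ 3
  class-of-leader≤3 {k} (tk , _) = begin
    classSize apexes leader k                  ≡⟨ classSize≡count apexes leader k ⟩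
    count (inClass apexes leader k)            ≤⟨ count-mono on-τₖ ⟩
    count (does ∘ onTriangle? (triangle k)) ≤⟨ #onTriangle≤3 (triangle k) ⟩
    3                                     ∎
    where
    open ≤-Reasoning
    on-τₖ : ∀ v → inClass apexes leader k v ≡ true → does (onTriangle? (triangle k) v) ≡ true
    on-τₖ v member with inClass-true {X = apexes} {c = leader} member | triangular? v
    ... | _ , refl | yes tv = dec-true (onTriangle? _ v) (tv , sym (proj₂ (leader-triangular tv)))
    ... | _ , refl | no ¬tv = contradiction (subst Triangular (leader-fixed ¬tv) tk) ¬tv

  class-of-non-leader≤1 : ∀ {k} → ¬ IsLeader k → classSize apexes leader k ≤ 1
  class-of-non-leader≤1 {k} ¬lk = begin
    classSize apexes leader k                  ≡⟨ classSize≡count apexes leader k ⟩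
    count (inClass apexes leader k)            ≤⟨ count≤code-bound 1 _ (λ _ → 0) (λ _ _ → s≤s z≤n)
                                               (λ u v mu mv _ → trans (is-k u mu) (sym (is-k v mv))) ⟩
    1                                     ∎
    where
    open ≤-Reasoning
    is-k : ∀ v → inClass apexes leader k v ≡ true → v ≡ k
    is-k v member with inClass-true {X = apexes} {c = leader} member | triangular? v
    ... | _ , refl | yes tv = contradiction (proj₁ (leader-triangular tv)) ¬lk
    ... | _ , ℓᵥ≡k | no ¬tv = trans (sym (leader-fixed ¬tv)) ℓᵥ≡k

  half-class≤leader : ∀ k → ⌊ classSize apexes leader k /2⌋ ≤ 𝟙 (does (isLeader? k))
  half-class≤leader k = by-cases (isLeader? k)
    where
    by-cases : (d : Dec (IsLeader k)) → ⌊ classSize apexes leader k /2⌋ ≤ 𝟙 (does d)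
    by-cases (yes lk)  = ⌊n/2⌋-mono (class-of-leader≤3 lk)
    by-cases (no  ¬lk) = ⌊n/2⌋-mono (class-of-non-leader≤1 ¬lk)

  apexes∈𝒳 : a ≤ n → InXset (a + m) H apexes
  apexes∈𝒳 a≤n = leader , apex-labelling , (begin
    cost apexes leader                                     ≡⟨ cost≡ apexes leader ⟩
    ∣ apexes ∣ + ∑[ k < n ] ⌊ classSize apexes leader k /2⌋     ≤⟨ +-mono-≤ (≤-reflexive (∣apexes∣≡a a≤n)) (∑-mono-≤ half-class≤leader) ⟩
    a + count (does ∘ isLeader?)                       ≤⟨ +-monoʳ-≤ a #leaders≤m ⟩
    a + m                                             ∎)
    where open ≤-Reasoning

  apex-degree : ∀ {i} → Apex i → count (not ∘ does ∘ apex?) ≤ degree H i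
  apex-degree {i} ai = count-mono λ j ¬aj → Adjacent⇒Adj (i≢j j ¬aj , inj₁ ai)
    where
    i≢j : ∀ j → not (does (apex? j)) ≡ true → i ≢ j
    i≢j j ¬aj refl rewrite dec-true (apex? i) ai with () ← ¬aj

  non-apex-degree : ∀ {i} → ¬ Apex i → count (does ∘ apex?) ≤ degree H i
  non-apex-degree {i} ¬ai = count-mono λ j aj →
    Adjacent⇒Adj ((λ { refl → ¬ai (witness (apex? j) aj) }) , inj₂ (inj₁ (witness (apex? j) aj)))

  #apex*#non-apex≤e : count (does ∘ apex?) * count (not ∘ does ∘ apex?) ≤ e H
  #apex*#non-apex≤e = *-cancelˡ-≤ 2 (begin
    2 * (α * β)                                          ≡⟨ cong (α * β +_) (trans (+-identityʳ (α * β)) (*-comm α β)) ⟩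
    α * β + β * α                                        ≡⟨ cong₂ _+_ (*-distribʳ-sum β (𝟙 ∘ does ∘ apex?))
                                                                      (*-distribʳ-sum α (𝟙 ∘ not ∘ does ∘ apex?)) ⟩
    ∑[ i < n ] (𝟙 (does (apex? i)) * β) + ∑[ i < n ] (𝟙 (not (does (apex? i))) * α)
                                                         ≡⟨ ∑-distrib-+ (λ i → 𝟙 (does (apex? i)) * β) (λ i → 𝟙 (not (does (apex? i))) * α) ⟨
    ∑[ i < n ] (𝟙 (does (apex? i)) * β + 𝟙 (not (does (apex? i))) * α) ≤⟨ ∑-mono-≤ degree≥ ⟩
    ∑[ i < n ] degree H i                                ≡⟨ handshake H ⟩
    2 * e H                                              ∎)
    where
    open ≤-Reasoning
    α : ℕ
    α = count (does ∘ apex?)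
    β : ℕ
    β = count (not ∘ does ∘ apex?)
    degree≥ : ∀ i → 𝟙 (does (apex? i)) * β + 𝟙 (not (does (apex? i))) * α ≤ degree H i
    degree≥ i = by-cases (apex? i)
      where
      by-cases : (d : Dec (Apex i)) → 𝟙 (does d) * β + 𝟙 (not (does d)) * α ≤ degree H i
      by-cases (yes ai)  = subst (_≤ degree H i) (sym (trans (+-identityʳ (1 * β)) (*-identityˡ β))) (apex-degree ai)
      by-cases (no  ¬ai) = subst (_≤ degree H i) (sym (*-identityˡ α)) (non-apex-degree ¬ai)

  module _ (n≥3s+2 : 3 * (a + m) + 2 ≤ n) where

    room : a + 3 * m ≤ n
    room = begin
      a + 3 * m                ≤⟨ +-monoˡ-≤ (3 * m) (m≤m+n a (2 * a)) ⟩
      a + 2 * a + 3 * m        ≡⟨ solve 2 (λ a m → a :+ con 2 :* a :+ con 3 :* m := con 3 :* (a :+ m)) refl a m ⟩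
      3 * (a + m)              ≤⟨ m≤m+n _ 2 ⟩
      3 * (a + m) + 2          ≤⟨ n≥3s+2 ⟩
      n                        ∎
      where open ≤-Reasoning

    a≤n : a ≤ n
    a≤n = ≤-trans (m≤m+n a _) room

    corner : Fin m → Fin 3 → Fin n
    corner τ r = fromℕ< (≤-trans (+-monoʳ-< a r+3τ<3m) room)
      where
      r+3τ<3m : toℕ r + toℕ τ * 3 < 3 * m
      r+3τ<3m = ≤-trans (+-monoˡ-< (toℕ τ * 3) (Finₚ.toℕ<n r))
                        (≤-trans (*-monoˡ-≤ 3 (Finₚ.toℕ<n τ)) (≤-reflexive (*-comm m 3)))

    corner-coordinates : ∀ τ r → a ≤ toℕ (corner τ r) × triangle (corner τ r) ≡ toℕ τ × position (corner τ r) ≡ toℕ r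
    corner-coordinates τ r = coordinates (toℕ τ) (toℕ r) (Finₚ.toℕ<n r) (Finₚ.toℕ-fromℕ< _)

    corner-on-triangle : ∀ τ r → OnTriangle (toℕ τ) (corner τ r)
    corner-on-triangle τ r = (proj₁ coords , subst (_< m) (sym (proj₁ (proj₂ coords))) (Finₚ.toℕ<n τ)) , proj₁ (proj₂ coords)
      where
      coords : a ≤ toℕ (corner τ r) × triangle (corner τ r) ≡ toℕ τ × position (corner τ r) ≡ toℕ r
      coords = corner-coordinates τ r

    corner-injective : ∀ τ {r r′} → corner τ r ≡ corner τ r′ → r ≡ r′
    corner-injective τ {r} {r′} e = Finₚ.toℕ-injective (begin
      toℕ r                    ≡⟨ proj₂ (proj₂ (corner-coordinates τ r)) ⟨
      position (corner τ r)    ≡⟨ cong position e ⟩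
      position (corner τ r′)   ≡⟨ proj₂ (proj₂ (corner-coordinates τ r′)) ⟩
      toℕ r′                   ∎)
      where open ≡-Reasoning

    corner-not-apex : ∀ τ r → ¬ Apex (corner τ r)
    corner-not-apex τ r = ≤⇒≯ (proj₁ (corner-coordinates τ r))

    corners-adjacent : ∀ τ {r r′} → r ≢ r′ → Adj H (corner τ r) (corner τ r′)
    corners-adjacent τ {r} {r′} r≢r′ = dec-true (adjacent? (corner τ r) (corner τ r′))
      ((r≢r′ ∘ corner-injective τ) , inj₂ (inj₂ (proj₁ on , proj₁ on′ , trans (proj₂ on) (sym (proj₂ on′)))))
      where
      on : OnTriangle (toℕ τ) (corner τ r)
      on = corner-on-triangle τ r
      on′ : OnTriangle (toℕ τ) (corner τ r′)
      on′ = corner-on-triangle τ r′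

    module _ {X : Subset n} {c : Fin n → Fin n} (lab : IsComponentLabelling H X c) where

      apex-outside⇒costly : ∀ {k} → Apex k → k ∉ X → ¬ cost X c ≤ a + m
      apex-outside⇒costly {k} ak k∉X cost≤s = <⇒≱ (s<⌊/2⌋ (subst (3 * (a + m) + 2 ≤_) (sym ∣X∣+#outside≡n) n≥3s+2) ∣X∣≤s) (begin
        ⌊ count (not ∘ lookup X) /2⌋          ≡⟨ cong ⌊_/2⌋ (dominating-class lab k∉X dominates) ⟨
        ⌊ classSize X c (c k) /2⌋             ≤⟨ m≤n+m _ ∣ X ∣ ⟩
        ∣ X ∣ + ⌊ classSize X c (c k) /2⌋     ≤⟨ class≤cost X c (c k) ⟩
        cost X c                              ≤⟨ cost≤s ⟩
        a + m                                 ∎)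
        where
        open ≤-Reasoning
        dominates : ∀ v → v ∉ X → v ≢ k → Adj H v k
        dominates v _ v≢k = Adjacent⇒Adj (v≢k , inj₂ (inj₁ ak))
        ∣X∣≤s : ∣ X ∣ ≤ a + m
        ∣X∣≤s = ≤-trans (m≤m+n ∣ X ∣ _) (≤-trans (≤-reflexive (sym (cost≡ X c))) cost≤s)
        ∣X∣+#outside≡n : ∣ X ∣ + count (not ∘ lookup X) ≡ n
        ∣X∣+#outside≡n = trans (cong (_+ count (not ∘ lookup X)) (∣∣≡count X)) (count-complement (lookup X))

      module _ (apex⊆X : ∀ k → Apex k → lookup X k ≡ true) where

        ∉X⇒¬Apex : ∀ {v} → v ∉ X → ¬ Apex v
        ∉X⇒¬Apex {v} v∉X av with () ← trans (sym (∉⇒lookup≡false v∉X)) (apex⊆X v av)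

        reach⇒same-triangle : ∀ {u v} → Reach H X u v → triangle u ≡ triangle v
        reach⇒same-triangle (here _)         = refl
        reach⇒same-triangle (step u∉X uw r) =
          trans (proj₂ (proj₂ (edge-without-apex uw (∉X⇒¬Apex u∉X) (∉X⇒¬Apex (reach-start∉ r)))))
                (reach⇒same-triangle r)

        agreeing : ∀ τ → ∃ λ r → ∃ λ r′ → r ≢ r′ × lookup X (corner τ r) ≡ lookup X (corner τ r′)
        agreeing τ = two-of-three-agree (λ r → lookup X (corner τ r))

        r₁ : Fin m → Fin 3
        r₁ τ = proj₁ (agreeing τ)

        r₂ : Fin m → Fin 3
        r₂ τ = proj₁ (proj₂ (agreeing τ))

        r₁≢r₂ : ∀ τ → r₁ τ ≢ r₂ τ
        r₁≢r₂ τ = proj₁ (proj₂ (proj₂ (agreeing τ)))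

        inside : Fin m → Bool
        inside τ = lookup X (corner τ (r₁ τ))

        corners-agree : ∀ τ → inside τ ≡ lookup X (corner τ (r₂ τ))
        corners-agree τ = proj₂ (proj₂ (proj₂ (agreeing τ)))

        #outside≤∑ : count (not ∘ inside) ≤ ∑[ k < n ] ⌊ classSize X c k /2⌋
        #outside≤∑ = begin
          count (not ∘ inside)                 ≤⟨ count-injection (not ∘ inside) (λ k → 1 <ᵇ classSize X c k)
                                                    (c ∘ first) nontrivial-class first-injective ⟩
          count (λ k → 1 <ᵇ classSize X c k)   ≤⟨ ∑-mono-≤ (λ k → 𝟙[1<]≤⌊/2⌋ (classSize X c k)) ⟩
          ∑[ k < n ] ⌊ classSize X c k /2⌋     ∎
          where
          open ≤-Reasoning
          first : Fin m → Fin n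
          first τ = corner τ (r₁ τ)
          nontrivial-class : ∀ τ → not (inside τ) ≡ true → (1 <ᵇ classSize X c (c (first τ))) ≡ true
          nontrivial-class τ out = dec-true (1 <? classSize X c (c (first τ)))
            (edge⇒class≥2 lab (corners-adjacent τ (r₁≢r₂ τ)) (not-injective out) (trans (sym (corners-agree τ)) (not-injective out)))
          first-injective : ∀ τ τ′ → not (inside τ) ≡ true → not (inside τ′) ≡ true → c (first τ) ≡ c (first τ′) → τ ≡ τ′
          first-injective τ τ′ out out′ e = Finₚ.toℕ-injective (begin-equality
            toℕ τ                 ≡⟨ proj₂ (corner-on-triangle τ (r₁ τ)) ⟨
            triangle (first τ)    ≡⟨ reach⇒same-triangle reach ⟩
            triangle (first τ′)   ≡⟨ proj₂ (corner-on-triangle τ′ (r₁ τ′)) ⟩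
            toℕ τ′                ∎)
            where
            reach : Reach H X (first τ) (first τ′)
            reach = Equivalence.to (lab _ _ (lookup≡false⇒∉ (not-injective out)) (lookup≡false⇒∉ (not-injective out′))) e

        module _ {z} (¬az : ¬ Apex z) (Xz : lookup X z ≡ true) where

          avoiding-z : ∀ τ → ∃ λ r → corner τ r ≢ z × lookup X (corner τ r) ≡ inside τ
          avoiding-z τ = by-cases (corner τ (r₁ τ) Fin.≟ z)
            where
            by-cases : Dec (corner τ (r₁ τ) ≡ z) → ∃ λ r → corner τ r ≢ z × lookup X (corner τ r) ≡ inside τ
            by-cases (no  c₁≢z) = r₁ τ , c₁≢z , refl
            by-cases (yes c₁≡z) = r₂ τ , (λ c₂≡z → r₁≢r₂ τ (corner-injective τ (trans c₁≡z (sym c₂≡z)))) , sym (corners-agree τ)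

          pick : Fin m → Fin n
          pick τ = corner τ (proj₁ (avoiding-z τ))

          -- z together with one vertex of X on each triangle whose agreeing corners lie in X.
          chosen : Fin (suc m) → Fin n
          chosen Fin.zero    = z
          chosen (Fin.suc τ) = pick τ

          counted : Fin (suc m) → Bool
          counted Fin.zero    = true
          counted (Fin.suc τ) = inside τ

          non-apex-in-X : Fin n → Bool
          non-apex-in-X v = lookup X v ∧ not (does (apex? v))

          #inside<#non-apex-in-X : suc (count inside) ≤ count non-apex-in-X
          #inside<#non-apex-in-X = count-injection counted non-apex-in-X chosen counted⇒non-apex-in-X chosen-injective
            where
            counted⇒non-apex-in-X : ∀ i → counted i ≡ true → non-apex-in-X (chosen i) ≡ true
            counted⇒non-apex-in-X Fin.zero    _    = cong₂ (λ x y → x ∧ not y) Xz (dec-false (apex? z) ¬az)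
            counted⇒non-apex-in-X (Fin.suc τ) in-τ = cong₂ (λ x y → x ∧ not y) (trans (proj₂ (proj₂ (avoiding-z τ))) in-τ)
                                                           (dec-false (apex? (pick τ)) (corner-not-apex τ (proj₁ (avoiding-z τ))))
            chosen-injective : ∀ i j → counted i ≡ true → counted j ≡ true → chosen i ≡ chosen j → i ≡ j
            chosen-injective Fin.zero    Fin.zero     _ _ _ = refl
            chosen-injective Fin.zero    (Fin.suc τ)  _ _ e = ⊥-elim (proj₁ (proj₂ (avoiding-z τ)) (sym e))
            chosen-injective (Fin.suc τ) Fin.zero     _ _ e = ⊥-elim (proj₁ (proj₂ (avoiding-z τ)) e)
            chosen-injective (Fin.suc τ) (Fin.suc τ′) _ _ e = cong Fin.suc (Finₚ.toℕ-injective
              (trans (sym (proj₂ (corner-on-triangle τ (proj₁ (avoiding-z τ)))))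
                     (trans (cong triangle e) (proj₂ (corner-on-triangle τ′ (proj₁ (avoiding-z τ′)))))))

          a+#non-apex-in-X≤∣X∣ : a + count non-apex-in-X ≤ ∣ X ∣
          a+#non-apex-in-X≤∣X∣ = begin
            a + count non-apex-in-X                                            ≡⟨ cong (_+ count non-apex-in-X) (#apex≡a a≤n) ⟨
            count (does ∘ apex?) + count non-apex-in-X                          ≤⟨ +-monoˡ-≤ (count non-apex-in-X) (count-mono apex⇒in-X) ⟩
            count (λ v → lookup X v ∧ does (apex? v)) + count non-apex-in-X    ≡⟨ count-split (lookup X) (does ∘ apex?) ⟨
            count (lookup X)                                                   ≡⟨ ∣∣≡count X ⟨
            ∣ X ∣                                                              ∎
            where
            open ≤-Reasoning
            apex⇒in-X : ∀ v → does (apex? v) ≡ true → lookup X v ∧ does (apex? v) ≡ true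
            apex⇒in-X v av = cong₂ _∧_ (apex⊆X v (witness (apex? v) av)) av

          non-apex-inside⇒costly : ¬ cost X c ≤ a + m
          non-apex-inside⇒costly cost≤s = <-irrefl refl (≤-trans (begin
            suc (a + m)                                            ≡⟨ cong (λ k → suc (a + k)) (count-complement inside) ⟨
            suc (a + (count inside + count (not ∘ inside)))        ≡⟨ +-suc a (count inside + count (not ∘ inside)) ⟨
            a + suc (count inside + count (not ∘ inside))          ≡⟨ +-assoc a (suc (count inside)) (count (not ∘ inside)) ⟨
            a + suc (count inside) + count (not ∘ inside)          ≤⟨ +-mono-≤ (+-monoʳ-≤ a #inside<#non-apex-in-X) #outside≤∑ ⟩
            a + count non-apex-in-X + ∑[ k < n ] ⌊ classSize X c k /2⌋ ≤⟨ +-monoˡ-≤ (∑[ k < n ] ⌊ classSize X c k /2⌋) a+#non-apex-in-X≤∣X∣ ⟩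
            ∣ X ∣ + ∑[ k < n ] ⌊ classSize X c k /2⌋               ≡⟨ cost≡ X c ⟨
            cost X c                                               ∎) cost≤s)
            where open ≤-Reasoning

      X∈𝒳⇒∣X∣≤a : cost X c ≤ a + m → ∣ X ∣ ≤ a
      X∈𝒳⇒∣X∣≤a cost≤s with Finₚ.any? (λ k → apex? k ×-dec (lookup X k ≟ᵇ false))
      ... | yes (k , ak , Xk) = ⊥-elim (apex-outside⇒costly ak (lookup≡false⇒∉ Xk) cost≤s)
      ... | no no-apex-outside with Finₚ.any? (λ z → ¬? (apex? z) ×-dec (lookup X z ≟ᵇ true))
      ...   | yes (z , ¬az , Xz) = ⊥-elim (non-apex-inside⇒costly apex⊆X ¬az Xz cost≤s)
        where
        apex⊆X : ∀ k → Apex k → lookup X k ≡ true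
        apex⊆X k ak = ¬-not (λ Xk → no-apex-outside (k , ak , Xk))
      ...   | no no-non-apex-inside = begin
        ∣ X ∣                  ≡⟨ ∣∣≡count X ⟩
        count (lookup X)       ≤⟨ count-mono X⇒apex ⟩
        count (does ∘ apex?)   ≤⟨ #apex≤a ⟩
        a                      ∎
        where
        open ≤-Reasoning
        X⇒apex : ∀ v → lookup X v ≡ true → does (apex? v) ≡ true
        X⇒apex v Xv = dec-true (apex? v) (decidable-stable (apex? v) (λ ¬av → no-non-apex-inside (v , ¬av , Xv)))

    x[H]≡a : HasX (a + m) H a
    x[H]≡a = (apexes , apexes∈𝒳 a≤n , ∣apexes∣≡a a≤n) , λ X (c , lab , cost≤s) → X∈𝒳⇒∣X∣≤a lab cost≤s

    e≤e[H] : ∀ (G : Graph n) (X : Subset n) → InXset (a + m) G X → ∣ X ∣ < a →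
             2 * ((3 * (a + m)) C 2) ≤ n → e G ≤ e H
    e≤e[H] G X X∈𝒳 ∣X∣<a n≥2C = *-cancelˡ-≤ 2 (begin
      2 * e G                                    ≤⟨ 2e≤2n∣X∣+[3s]² (a + m) G X X∈𝒳 ⟩
      2 * (n * ∣ X ∣) + S                        ≡⟨ cong (λ k → 2 * (k * ∣ X ∣) + S) a+β≡n ⟨
      2 * ((a + β) * ∣ X ∣) + S                  ≤⟨ 2[a+b]x+9s²≤2ab ∣X∣<a (m≤m+n a m)
                                                       (subst (2 * ((3 * (a + m)) C 2) ≤_) (sym a+β≡n) n≥2C) ⟩
      2 * (a * β)                                ≡⟨ cong (λ α → 2 * (α * β)) (#apex≡a a≤n) ⟨
      2 * (count (does ∘ apex?) * β)             ≤⟨ *-monoʳ-≤ 2 #apex*#non-apex≤e ⟩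
      2 * e H                                    ∎)
      where
      open ≤-Reasoning
      S : ℕ
      S = (3 * (a + m)) * (3 * (a + m))
      β : ℕ
      β = count (not ∘ does ∘ apex?)
      a+β≡n : a + β ≡ n
      a+β≡n = trans (cong (_+ β) (sym (#apex≡a a≤n))) (count-complement (does ∘ apex?))

lemma3p1 : (l t s n : ℕ) → 2 ≤ l → l ≤ t → l + 1 ≤ s → 3 ≤ l + 1 →
    2 * ((3 * s) C 2) ≤ n → (x : ℕ) → 1 ≤ x → x ≤ l ∸ 1 →
    (G : Graph n) → InGx l t s x G →
    Σ (Graph n) λ H → InGx l t s (l ∸ 1) H × e G ≤ e H
lemma3p1 (suc a) t s n _ l≤t l+1≤s _ n≥2C x 1≤x x≤a G G∈𝒢ₓ@(_ , (X , X∈𝒳 , ∣X∣≡x) , _)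
  with m , refl ← m≤n⇒∃[o]m+o≡n (≤-trans (n≤1+n a) (≤-trans (m≤m+n (suc a) 1) l+1≤s)) | x ≟ a
... | yes refl = G , G∈𝒢ₓ , ≤-refl
... | no x≢a   = H , ((K-free t 3≤t l≤t , M-free) , x[H]≡a n≥3s+2) , e≤e[H] n≥3s+2 G X X∈𝒳 (subst (_< a) (sym ∣X∣≡x) x<a) n≥2C
  where
  open Extremal a m n
  x<a : x < a
  x<a = ≤∧≢⇒< x≤a x≢a
  3≤t : 3 ≤ t
  3≤t = ≤-trans (s≤s (≤-trans (s≤s 1≤x) x<a)) l≤t
  n≥3s+2 : 3 * (a + m) + 2 ≤ n
  n≥3s+2 = ≤-trans (3s+2≤2*[3sC2] (≤-trans (s≤s z≤n) (≤-trans x<a (m≤m+n a m)))) n≥2C
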